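{- Let $p$ be a prime, $v_p$ the $p$-adic valuation on $\mathbb{Q}_p$ (with $v_p(0)=+\infty$), and $S=SL_2(\mathbb{Q}_p)$. Then: (1) The set $W=\{A\in S : v_p(\operatorname{tr}(A))<0\}$ is generic in $S$. (2) The set $W'=\{A\in S : v_p(\operatorname{tr}(A))\ge 0\}$ is not generic in $S$.
   Context: A subset $X$ of a group $G$ is (left-)generic if $G$ is covered by finitely many left translates $gX$ of $X$. -}

module Defs where

open import Data.Nat as ℕ using (ℕ; suc)
open import Data.Integer as ℤ using (ℤ; +_)
open import Data.Integer.Divisibility using (_∣_)
open import Data.List using (List)
open import Data.List.Relation.Unary.Any using (Any)
open import Data.Product using (Σ; _×_; _,_; proj₁; proj₂)
open import Relation.Nullary using (¬_)

-- Throughout, p : ℕ is the prime (primality is a hypothesis of the theorem).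

pow : ℕ → ℕ → ℤ
pow p n = + (p ℕ.^ n)

-- p-adic integers  ℤ_p = lim ℤ/p^n.
-- A sequence x : ℕ → ℤ represents the element whose residue mod p^n is
-- x n.  Such a sequence is a genuine element of ℤ_p iff it is coherent.
-- Ring operations are computed pointwise on (raw) sequences; they preserve
-- coherence, and all results are only compared up to the equality below.

RawZ : Set
RawZ = ℕ → ℤ

Coherent : ℕ → RawZ → Set
Coherent p x = ∀ n → pow p n ∣ (x (suc n) ℤ.- x n)

Zp : ℕ → Set
Zp p = Σ RawZ (Coherent p)

-- ℚ_p = ℤ_p[1/p]: pairs (x , k) standing for x / p^k.

RawQ : Set
RawQ = RawZ × ℕ

Qp : ℕ → Set
Qp p = Zp p × ℕ

raw : ∀ {p} → Qp p → RawQ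
raw ((x , _) , k) = x , k

-- equality in ℚ_p :  x / p^k = y / p^l  iff  x p^l = y p^k in ℤ_p,
-- i.e. the two sides agree modulo p^n for every n.
_≈[_]_ : RawQ → ℕ → RawQ → Set
(x , k) ≈[ p ] (y , l) = ∀ n → pow p n ∣ ((x n ℤ.* pow p l) ℤ.- (y n ℤ.* pow p k))

addQ : ℕ → RawQ → RawQ → RawQ
addQ p (x , k) (y , l) = (λ n → (x n ℤ.* pow p l) ℤ.+ (y n ℤ.* pow p k)) , (k ℕ.+ l)

mulQ : RawQ → RawQ → RawQ
mulQ (x , k) (y , l) = (λ n → x n ℤ.* y n) , (k ℕ.+ l)

negQ : RawQ → RawQ
negQ (x , k) = (λ n → ℤ.- (x n)) , k

subQ : ℕ → RawQ → RawQ → RawQ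
subQ p a b = addQ p a (negQ b)

oneQ : RawQ
oneQ = (λ _ → + 1) , 0

-- p-adic valuation condition  v_p(x / p^k) ≥ 0 , i.e. v_p(x) ≥ k,
-- i.e. x ≡ 0 mod p^k (with v_p(0) = +∞ this holds for x = 0).
-- Its negation is  v_p(x / p^k) < 0.
ValNonneg : ℕ → RawQ → Set
ValNonneg p (x , k) = pow p k ∣ x k

record Mat (A : Set) : Set where
  constructor mat
  field
    a b c d : A
open Mat public

rawM : ∀ {p} → Mat (Qp p) → Mat RawQ
rawM (mat a b c d) = mat (raw a) (raw b) (raw c) (raw d)

mulM : ℕ → Mat RawQ → Mat RawQ → Mat RawQ
mulM p (mat a b c d) (mat a' b' c' d') =
  mat (addQ p (mulQ a a') (mulQ b c')) (addQ p (mulQ a b') (mulQ b d'))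
      (addQ p (mulQ c a') (mulQ d c')) (addQ p (mulQ c b') (mulQ d d'))

_≈M[_]_ : Mat RawQ → ℕ → Mat RawQ → Set
M ≈M[ p ] N = (a M ≈[ p ] a N) × (b M ≈[ p ] b N) × (c M ≈[ p ] c N) × (d M ≈[ p ] d N)

det : ℕ → Mat RawQ → RawQ
det p (mat a b c d) = subQ p (mulQ a d) (mulQ b c)

tr : ℕ → Mat RawQ → RawQ
tr p (mat a b c d) = addQ p a d

record SL2 (p : ℕ) : Set where
  constructor sl2
  field
    entries : Mat (Qp p)
    det≈1   : det p (rawM entries) ≈[ p ] oneQ
open SL2 public

-- Genericity: X ⊆ S is (left-)generic if S is covered by finitely many
-- left translates gX (g ∈ S).  A ∈ gX  iff  A = g·B for some B ∈ X.

InTranslate : ∀ {p} → (SL2 p → Set) → SL2 p → SL2 p → Set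
InTranslate {p} X g A =
  Σ (SL2 p) λ B → X B × (rawM (entries A) ≈M[ p ] mulM p (rawM (entries g)) (rawM (entries B)))

Generic : ∀ {p} → (SL2 p → Set) → Set
Generic {p} X = Σ (List (SL2 p)) λ gs → ∀ (A : SL2 p) → Any (λ g → InTranslate X g A) gs

W : ∀ p → SL2 p → Set
W p A = ¬ ValNonneg p (tr p (rawM (entries A)))

W' : ∀ p → SL2 p → Set
W' p A = ValNonneg p (tr p (rawM (entries A)))

-- (1) For A = (x y; z w), left multiplication by I, S = (0 1; −1 0), S′ = (1/p 1; −1 0) and
-- L = (1 0; 1/p 1) gives matrices with traces x + w, z − y, x/p + z − y and x + y/p + w. If all four
-- were in ℤ_p then so would be x/p, y/p, z and w, making det A divisible by p; so every A lies in one
-- of the four translates h⁻¹W.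
-- (2) A ∈ gW′ iff tr(g⁻¹A) ∈ ℤ_p. Given g₁, …, g_n, let p^K bound the denominators of their top rows
-- and take A_m = (p^-(1+K) p^-(1+m+K); 0 p^(1+K)). By pigeonhole two of A_0, …, A_n, say A_I and
-- A_J with I < J, lie in the same gW′ with g = (a b; c d). Comparing the two traces shows that
-- c p^-(1+I+K) is integral (p^(J−I) − 1 is a unit of ℤ_p), then so is d p^-(1+K), and then
-- det g = ad − bc is divisible by p, a contradiction.

module Submission where

open import Defs
open import Data.Nat using (ℕ)
open import Data.Nat.Primality using (Prime)
open import Data.Product using (_×_)
open import Relation.Nullary using (¬_)

import Data.Nat as ℕ
open import Data.Nat using (zero; suc)
import Data.Nat.Properties as ℕP
import Data.Nat.Divisibility as ℕD
import Data.Nat.Primality as Primality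
open import Data.Integer as ℤ using (ℤ; +_; -[1+_]; _+_; _*_; -_; _-_)
import Data.Integer.Properties as ℤP
import Data.Integer.Tactic.RingSolver as ℤ-Solver
open import Data.Integer.Divisibility.Signed as ∣ˢ
  using (divides; ∣m∣n⇒∣m+n; ∣m∣n⇒∣m-n; ∣m⇒∣-m; ∣n⇒∣m*n; ∣m⇒∣m*n; ∣-trans)
  renaming (_∣_ to _∣ˢ_)
open import Data.Product using (Σ; _,_; proj₁; proj₂)
open import Data.List as List using (List; []; _∷_)
open import Data.List.Relation.Unary.Any as Any using (Any)
import Data.List.Relation.Unary.Any.Properties as Any
open import Data.List.Relation.Unary.Any.Properties using (lookup-index)
open import Data.List.Relation.Unary.All as All using (All; []; _∷_)
open import Data.List.Relation.Unary.All.Properties as All using (¬All⇒Any¬)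
open import Data.List.Membership.Propositional.Properties using (∈-lookup)
open import Data.List.Extrema.Nat using (max; xs≤max)
open import Data.Fin as Fin using (Fin)
import Data.Fin.Properties as FinP
open import Data.Maybe using (nothing)
open import Data.Empty using (⊥)
open import Relation.Binary.PropositionalEquality
open import Relation.Nullary using (Dec; does)
open import Data.Vec using (Vec)
open import Tactic.RingSolver.Core.AlmostCommutativeRing
  using (AlmostCommutativeRing; _-Raw-AlmostCommutative⟶_)
open import Tactic.RingSolver.Core.Polynomial.Parameters using (Homomorphism)
open import Tactic.RingSolver.Core.Expression using (Expr; Κ; Ι; _⊕_; _⊗_; ⊝_; _⊛_; module Eval)

module _ (p : ℕ) (p≥2 : 2 ℕ.≤ p) where

  instance
    p-nonZero : ℕ.NonZero p
    p-nonZero = ℕ.>-nonZero (ℕP.<-≤-trans (ℕ.s≤s ℕ.z≤n) p≥2)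

  p^ : ℕ → ℤ
  p^ = pow p

  p^-nonZero : ∀ n → ℤ.NonZero (p^ n)
  p^-nonZero n = ℕP.m^n≢0 p n

  p^-+ : ∀ m n → p^ (m ℕ.+ n) ≡ p^ m * p^ n
  p^-+ m n = trans (cong +_ (ℕP.^-distribˡ-+-* p m n)) (ℤP.pos-* (p ℕ.^ m) (p ℕ.^ n))

  ∣0 : ∀ {d} → d ∣ˢ + 0
  ∣0 {d} = divides (+ 0) (sym (ℤP.*-zeroˡ d))

  p^-mono-∣ : ∀ {m n} → m ℕ.≤ n → p^ m ∣ˢ p^ n
  p^-mono-∣ {m} {n} m≤n = divides (p^ (n ℕ.∸ m)) (begin
    p^ n                     ≡⟨ cong p^ (ℕP.m+[n∸m]≡n m≤n) ⟨
    p^ (m ℕ.+ (n ℕ.∸ m))     ≡⟨ p^-+ m (n ℕ.∸ m) ⟩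
    p^ m * p^ (n ℕ.∸ m)      ≡⟨ ℤP.*-comm (p^ m) _ ⟩
    p^ (n ℕ.∸ m) * p^ m      ∎)
    where open ≡-Reasoning

  p^-∣-weaken : ∀ {m n a} → m ℕ.≤ n → p^ n ∣ˢ a → p^ m ∣ˢ a
  p^-∣-weaken m≤n = ∣-trans (p^-mono-∣ m≤n)

  p^-∣-cancelˡ : ∀ m l {a} → p^ (m ℕ.+ l) ∣ˢ (p^ l * a) → p^ m ∣ˢ a
  p^-∣-cancelˡ m l d = ∣ˢ.*-cancelˡ-∣ (p^ l) {{p^-nonZero l}}
    (subst (_∣ˢ _) (trans (p^-+ m l) (ℤP.*-comm (p^ m) (p^ l))) d)

  p^-∣-*ʳ : ∀ m l {a} → p^ m ∣ˢ a → p^ (m ℕ.+ l) ∣ˢ (a * p^ l)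
  p^-∣-*ʳ m l d = subst (_∣ˢ _) (sym (p^-+ m l)) (∣ˢ.*-monoˡ-∣ (p^ l) d)

  p^-suc-∤-p^ : ∀ k → ¬ p^ (suc k) ∣ˢ p^ k
  p^-suc-∤-p^ k d = ℕP.<⇒≱ p^k<p^1+k (ℕD.∣⇒≤ {{ℕP.m^n≢0 p k}} (∣ˢ.∣⇒∣ᵤ d))
    where
    p^k<p^1+k : p ℕ.^ k ℕ.< p ℕ.^ suc k
    p^k<p^1+k = subst (p ℕ.^ k ℕ.<_) (ℕP.*-comm (p ℕ.^ k) p) (ℕP.m<m*n (p ℕ.^ k) p {{ℕP.m^n≢0 p k}} p≥2)

  -- Arithmetic of ℚ_p on representatives

  -- Equality of ℚ_p on raw representatives. Unlike _≈[ p ]_ it is transitive without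
  -- coherence; on coherent representatives the two agree (≈⇒≃, ≃⇒≈).
  infix 4 _≃_
  record _≃_ (a b : RawQ) : Set where
    constructor mk≃
    field
      eventually : ∀ m → Σ ℕ λ N → ∀ n → N ℕ.≤ n →
                   p^ m ∣ˢ (proj₁ a n * p^ (proj₂ b) - proj₁ b n * p^ (proj₂ a))

  ≤⊔⇒≤ˡ : ∀ {a b n} → a ℕ.⊔ b ℕ.≤ n → a ℕ.≤ n
  ≤⊔⇒≤ˡ {a} {b} = ℕP.≤-trans (ℕP.m≤m⊔n a b)

  ≤⊔⇒≤ʳ : ∀ {a b n} → a ℕ.⊔ b ℕ.≤ n → b ℕ.≤ n
  ≤⊔⇒≤ʳ {a} {b} = ℕP.≤-trans (ℕP.m≤n⊔m a b)

  cross-≡⇒≃ : ∀ {a b} → (∀ n → proj₁ a n * p^ (proj₂ b) ≡ proj₁ b n * p^ (proj₂ a)) → a ≃ b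
  cross-≡⇒≃ {x , k} {y , l} e = mk≃ λ _ → 0 , λ n _ →
    subst (_ ∣ˢ_) (sym (trans (cong (_- (y n * p^ k)) (e n)) (ℤP.+-inverseʳ (y n * p^ k)))) ∣0

  ≃-refl : ∀ {a} → a ≃ a
  ≃-refl = cross-≡⇒≃ λ _ → refl

  ≃-sym : ∀ {a b} → a ≃ b → b ≃ a
  ≃-sym {x , k} {y , l} (mk≃ a≃b) = mk≃ λ m → proj₁ (a≃b m) , λ n N≤n →
    subst (_ ∣ˢ_) (negate-difference (x n * p^ l) (y n * p^ k)) (∣m⇒∣-m (proj₂ (a≃b m) n N≤n))
    where
    negate-difference : ∀ a b → - (a - b) ≡ b - a
    negate-difference = ℤ-Solver.solve-∀

  -- The two hypotheses combine to p^l times the required difference, so they are used at precision m + l.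
  ≃-trans : ∀ {a b c} → a ≃ b → b ≃ c → a ≃ c
  ≃-trans {x , k} {y , l} {z , j} (mk≃ a≃b) (mk≃ b≃c) = mk≃ λ m →
    let (N₁ , ab) = a≃b (m ℕ.+ l); (N₂ , bc) = b≃c (m ℕ.+ l) in
    N₁ ℕ.⊔ N₂ , λ n N≤n → p^-∣-cancelˡ m l
      (subst (_ ∣ˢ_) (combine (x n) (y n) (z n) (p^ k) (p^ l) (p^ j))
        (∣m∣n⇒∣m+n (∣m⇒∣m*n (p^ j) (ab n (≤⊔⇒≤ˡ N≤n))) (∣m⇒∣m*n (p^ k) (bc n (≤⊔⇒≤ʳ N≤n)))))
    where
    combine : ∀ x y z K L J → (x * L - y * K) * J + (y * J - z * L) * K ≡ L * (x * J - z * K)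
    combine = ℤ-Solver.solve-∀

  infixl 6 _+ᵣ_ _-ᵣ_
  infixl 7 _*ᵣ_
  infix 8 -ᵣ_

  _+ᵣ_ _*ᵣ_ _-ᵣ_ : RawQ → RawQ → RawQ
  _+ᵣ_ = addQ p
  _*ᵣ_ = mulQ
  _-ᵣ_ = subQ p

  -ᵣ_ : RawQ → RawQ
  -ᵣ_ = negQ

  ⟨_⟩ : ℤ → RawQ
  ⟨ c ⟩ = (λ _ → c) , 0

  +ᵣ-cong : ∀ {a a' b b'} → a ≃ a' → b ≃ b' → a +ᵣ b ≃ a' +ᵣ b'
  +ᵣ-cong {x , k} {x' , k'} {y , l} {y' , l'} (mk≃ a≃a') (mk≃ b≃b') = mk≃ λ m →
    let (N₁ , aa) = a≃a' m; (N₂ , bb) = b≃b' m in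
    N₁ ℕ.⊔ N₂ , λ n N≤n →
    subst (_ ∣ˢ_) (sym (trans (cong₂ (λ u v → (x n * p^ l + y n * p^ k) * u - (x' n * p^ l' + y' n * p^ k') * v)
                                     (p^-+ k' l') (p^-+ k l))
                              (split (x n) (x' n) (y n) (y' n) (p^ k) (p^ k') (p^ l) (p^ l'))))
      (∣m∣n⇒∣m+n (∣n⇒∣m*n (p^ l * p^ l') (aa n (≤⊔⇒≤ˡ N≤n))) (∣n⇒∣m*n (p^ k * p^ k') (bb n (≤⊔⇒≤ʳ N≤n))))
    where
    split : ∀ x x' y y' A A' B B' → (x * B + y * A) * (A' * B') - (x' * B' + y' * A') * (A * B)
            ≡ (B * B') * (x * A' - x' * A) + (A * A') * (y * B' - y' * B)
    split = ℤ-Solver.solve-∀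

  *ᵣ-cong : ∀ {a a' b b'} → a ≃ a' → b ≃ b' → a *ᵣ b ≃ a' *ᵣ b'
  *ᵣ-cong {x , k} {x' , k'} {y , l} {y' , l'} (mk≃ a≃a') (mk≃ b≃b') = mk≃ λ m →
    let (N₁ , aa) = a≃a' m; (N₂ , bb) = b≃b' m in
    N₁ ℕ.⊔ N₂ , λ n N≤n →
    subst (_ ∣ˢ_) (sym (trans (cong₂ (λ u v → (x n * y n) * u - (x' n * y' n) * v) (p^-+ k' l') (p^-+ k l))
                              (split (x n) (x' n) (y n) (y' n) (p^ k) (p^ k') (p^ l) (p^ l'))))
      (∣m∣n⇒∣m+n (∣m⇒∣m*n (y n * p^ l') (aa n (≤⊔⇒≤ˡ N≤n))) (∣n⇒∣m*n (x' n * p^ k) (bb n (≤⊔⇒≤ʳ N≤n))))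
    where
    split : ∀ x x' y y' A A' B B' → (x * y) * (A' * B') - (x' * y') * (A * B)
            ≡ (x * A' - x' * A) * (y * B') + (x' * A) * (y * B' - y' * B)
    split = ℤ-Solver.solve-∀

  -ᵣ-cong : ∀ {a a'} → a ≃ a' → -ᵣ a ≃ -ᵣ a'
  -ᵣ-cong {x , k} {x' , k'} (mk≃ a≃a') = mk≃ λ m → proj₁ (a≃a' m) , λ n N≤n →
    subst (_ ∣ˢ_) (sym (negate (x n) (x' n) (p^ k) (p^ k'))) (∣m⇒∣-m (proj₂ (a≃a' m) n N≤n))
    where
    negate : ∀ x x' A A' → (- x) * A' - (- x') * A ≡ - (x * A' - x' * A)
    negate = ℤ-Solver.solve-∀

  0ᵣ 1ᵣ : RawQ
  0ᵣ = ⟨ + 0 ⟩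
  1ᵣ = oneQ

  -- Each law is an integer polynomial identity once the powers of p are expanded with p^-+;
  -- the expansions are passed as equations and eliminated by matching on refl.
  +ᵣ-assoc : ∀ a b c → (a +ᵣ b) +ᵣ c ≃ a +ᵣ (b +ᵣ c)
  +ᵣ-assoc (x , k) (y , l) (z , j) = cross-≡⇒≃ λ n → identity (x n) (y n) (z n)
    (p^-+ k l) (p^-+ l j) (p^-+ k (l ℕ.+ j)) (p^-+ (k ℕ.+ l) j)
    where
    polynomial : ∀ x y z A B C → ((x * B + y * A) * C + z * (A * B)) * (A * (B * C))
                                 ≡ (x * (B * C) + (y * C + z * B) * A) * ((A * B) * C)
    polynomial = ℤ-Solver.solve-∀
    identity : ∀ x y z {AB BC ABC ABC'} → AB ≡ p^ k * p^ l → BC ≡ p^ l * p^ j →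
               ABC' ≡ p^ k * BC → ABC ≡ AB * p^ j →
               ((x * p^ l + y * p^ k) * p^ j + z * AB) * ABC' ≡ (x * BC + (y * p^ j + z * p^ l) * p^ k) * ABC
    identity x y z refl refl refl refl = polynomial x y z (p^ k) (p^ l) (p^ j)

  +ᵣ-comm : ∀ a b → a +ᵣ b ≃ b +ᵣ a
  +ᵣ-comm (x , k) (y , l) = cross-≡⇒≃ λ n → identity (x n) (y n) (p^-+ k l) (p^-+ l k)
    where
    polynomial : ∀ x y A B → (x * B + y * A) * (B * A) ≡ (y * A + x * B) * (A * B)
    polynomial = ℤ-Solver.solve-∀
    identity : ∀ x y {AB BA} → AB ≡ p^ k * p^ l → BA ≡ p^ l * p^ k →
               (x * p^ l + y * p^ k) * BA ≡ (y * p^ k + x * p^ l) * AB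
    identity x y refl refl = polynomial x y (p^ k) (p^ l)

  +ᵣ-identityˡ : ∀ a → 0ᵣ +ᵣ a ≃ a
  +ᵣ-identityˡ (x , k) = cross-≡⇒≃ λ n → polynomial (x n) (p^ k)
    where
    polynomial : ∀ x A → (+ 0 * A + x * + 1) * A ≡ x * A
    polynomial = ℤ-Solver.solve-∀

  +ᵣ-identityʳ : ∀ a → a +ᵣ 0ᵣ ≃ a
  +ᵣ-identityʳ (x , k) = cross-≡⇒≃ λ n → identity (x n) (p^-+ k 0)
    where
    polynomial : ∀ x A → (x * + 1 + + 0 * A) * A ≡ x * (A * + 1)
    polynomial = ℤ-Solver.solve-∀
    identity : ∀ x {A0} → A0 ≡ p^ k * + 1 → (x * + 1 + + 0 * p^ k) * p^ k ≡ x * A0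
    identity x refl = polynomial x (p^ k)

  *ᵣ-assoc : ∀ a b c → (a *ᵣ b) *ᵣ c ≃ a *ᵣ (b *ᵣ c)
  *ᵣ-assoc (x , k) (y , l) (z , j) = cross-≡⇒≃ λ n →
    cong₂ _*_ (ℤP.*-assoc (x n) (y n) (z n)) (cong p^ (sym (ℕP.+-assoc k l j)))

  *ᵣ-comm : ∀ a b → a *ᵣ b ≃ b *ᵣ a
  *ᵣ-comm (x , k) (y , l) = cross-≡⇒≃ λ n → cong₂ _*_ (ℤP.*-comm (x n) (y n)) (cong p^ (ℕP.+-comm l k))

  *ᵣ-identityˡ : ∀ a → 1ᵣ *ᵣ a ≃ a
  *ᵣ-identityˡ (x , k) = cross-≡⇒≃ λ n → cong (_* p^ k) (ℤP.*-identityˡ (x n))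

  *ᵣ-identityʳ : ∀ a → a *ᵣ 1ᵣ ≃ a
  *ᵣ-identityʳ (x , k) = cross-≡⇒≃ λ n → cong₂ _*_ (ℤP.*-identityʳ (x n)) (cong p^ (sym (ℕP.+-identityʳ k)))

  *ᵣ-distribˡ-+ᵣ : ∀ a b c → a *ᵣ (b +ᵣ c) ≃ a *ᵣ b +ᵣ a *ᵣ c
  *ᵣ-distribˡ-+ᵣ (x , k) (y , l) (z , j) = cross-≡⇒≃ λ n → identity (x n) (y n) (z n)
    (p^-+ k l) (p^-+ k j) (p^-+ l j) (p^-+ (k ℕ.+ l) (k ℕ.+ j)) (p^-+ k (l ℕ.+ j))
    where
    polynomial : ∀ x y z A B C → (x * (y * C + z * B)) * ((A * B) * (A * C))
                                 ≡ ((x * y) * (A * C) + (x * z) * (A * B)) * (A * (B * C))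
    polynomial = ℤ-Solver.solve-∀
    identity : ∀ x y z {AB AC BC ABAC ABC} → AB ≡ p^ k * p^ l → AC ≡ p^ k * p^ j → BC ≡ p^ l * p^ j →
               ABAC ≡ AB * AC → ABC ≡ p^ k * BC →
               (x * (y * p^ j + z * p^ l)) * ABAC ≡ ((x * y) * AC + (x * z) * AB) * ABC
    identity x y z refl refl refl refl refl = polynomial x y z (p^ k) (p^ l) (p^ j)

  *ᵣ-distribʳ-+ᵣ : ∀ a b c → (b +ᵣ c) *ᵣ a ≃ b *ᵣ a +ᵣ c *ᵣ a
  *ᵣ-distribʳ-+ᵣ a b c = ≃-trans (*ᵣ-comm (b +ᵣ c) a)
    (≃-trans (*ᵣ-distribˡ-+ᵣ a b c) (+ᵣ-cong (*ᵣ-comm a b) (*ᵣ-comm a c)))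

  *ᵣ-zeroˡ : ∀ a → 0ᵣ *ᵣ a ≃ 0ᵣ
  *ᵣ-zeroˡ (x , k) = cross-≡⇒≃ λ n → polynomial (x n) (p^ k)
    where
    polynomial : ∀ x A → (+ 0 * x) * + 1 ≡ + 0 * A
    polynomial = ℤ-Solver.solve-∀

  *ᵣ-zeroʳ : ∀ a → a *ᵣ 0ᵣ ≃ 0ᵣ
  *ᵣ-zeroʳ a = ≃-trans (*ᵣ-comm a 0ᵣ) (*ᵣ-zeroˡ a)

  -ᵣ-distribˡ-*ᵣ : ∀ a b → (-ᵣ a) *ᵣ b ≃ -ᵣ (a *ᵣ b)
  -ᵣ-distribˡ-*ᵣ (x , k) (y , l) = cross-≡⇒≃ λ n → cong (_* p^ (k ℕ.+ l)) (sym (ℤP.neg-distribˡ-* (x n) (y n)))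

  -ᵣ-distrib-+ᵣ : ∀ a b → (-ᵣ a) +ᵣ (-ᵣ b) ≃ -ᵣ (a +ᵣ b)
  -ᵣ-distrib-+ᵣ (x , k) (y , l) = cross-≡⇒≃ λ n → cong (_* p^ (k ℕ.+ l)) (polynomial (x n) (y n) (p^ k) (p^ l))
    where
    polynomial : ∀ x y A B → (- x) * B + (- y) * A ≡ - (x * B + y * A)
    polynomial = ℤ-Solver.solve-∀

  ℚₚ-ring : AlmostCommutativeRing _ _
  ℚₚ-ring = record
    { Carrier = RawQ ; _≈_ = _≃_ ; _+_ = _+ᵣ_ ; _*_ = _*ᵣ_ ; -_ = -ᵣ_ ; 0# = 0ᵣ ; 1# = 1ᵣ ; 0≟_ = λ _ → nothing
    ; isAlmostCommutativeRing = record
      { isCommutativeSemiring = record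
        { isSemiring = record
          { isSemiringWithoutAnnihilatingZero = record
            { +-isCommutativeMonoid = record
              { isMonoid = record
                { isSemigroup = record
                  { isMagma = record
                    { isEquivalence = record { refl = ≃-refl ; sym = ≃-sym ; trans = ≃-trans }
                    ; ∙-cong = +ᵣ-cong }
                  ; assoc = +ᵣ-assoc }
                ; identity = +ᵣ-identityˡ , +ᵣ-identityʳ }
              ; comm = +ᵣ-comm }
            ; *-cong = *ᵣ-cong
            ; *-assoc = *ᵣ-assoc
            ; *-identity = *ᵣ-identityˡ , *ᵣ-identityʳ
            ; distrib = *ᵣ-distribˡ-+ᵣ , *ᵣ-distribʳ-+ᵣ }
          ; zero = *ᵣ-zeroˡ , *ᵣ-zeroʳ }
        ; *-comm = *ᵣ-comm }
      ; -‿cong = -ᵣ-cong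
      ; -‿*-distribˡ = -ᵣ-distribˡ-*ᵣ
      ; -‿+-comm = -ᵣ-distrib-+ᵣ } }

  ⟨⟩-morphism : ℤ.+-*-rawRing -Raw-AlmostCommutative⟶ ℚₚ-ring
  ⟨⟩-morphism = record
    { ⟦_⟧ = ⟨_⟩
    ; +-homo = λ a b → cross-≡⇒≃ λ _ → cong (_* + 1) (sym (cong₂ _+_ (ℤP.*-identityʳ a) (ℤP.*-identityʳ b)))
    ; *-homo = λ _ _ → ≃-refl
    ; -‿homo = λ _ → ≃-refl
    ; 0-homo = ≃-refl
    ; 1-homo = ≃-refl }

  -- Tactic.RingSolver.NonReflective would use ℚₚ-ring itself as coefficients, where zero is not
  -- decidable; with coefficients in ℤ, constants normalise and literal zeros are discarded.
  ℤ→ℚₚ : Homomorphism _ _ _ _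
  ℤ→ℚₚ = record
    { from = record { rawRing = ℤ.+-*-rawRing ; isZero = λ c → does (c ℤ.≟ + 0) }
    ; to = ℚₚ-ring
    ; morphism = ⟨⟩-morphism
    ; Zero-C⟶Zero-R = λ { (+ 0) _ → ≃-refl } }

  module ℚₚ-Solver where
    open Eval (AlmostCommutativeRing.rawRing ℚₚ-ring) ⟨_⟩
    open import Tactic.RingSolver.Core.Polynomial.Base (Homomorphism.from ℤ→ℚₚ)
    open import Tactic.RingSolver.Core.Polynomial.Homomorphism ℤ→ℚₚ
    open import Tactic.RingSolver.Core.Polynomial.Semantics ℤ→ℚₚ renaming (⟦_⟧ to ⟦_⟧ₚ)
    open import Algebra.Properties.Semiring.Exp.TCOptimised (AlmostCommutativeRing.semiring ℚₚ-ring)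
      using (^-congˡ)

    norm : ∀ {n} → Expr ℤ n → Poly n
    norm (Κ x)   = κ x
    norm (Ι x)   = ι x
    norm (x ⊕ y) = norm x ⊞ norm y
    norm (x ⊗ y) = norm x ⊠ norm y
    norm (⊝ x)   = ⊟ norm x
    norm (x ⊛ i) = norm x ⊡ i

    ⟦_⇓⟧ : ∀ {n} → Expr ℤ n → Vec RawQ n → RawQ
    ⟦ e ⇓⟧ = ⟦ norm e ⟧ₚ

    correct : ∀ {n} (e : Expr ℤ n) ρ → ⟦ e ⇓⟧ ρ ≃ ⟦ e ⟧ ρ
    correct (Κ x)   ρ = κ-hom x ρ
    correct (Ι x)   ρ = ι-hom x ρ
    correct (x ⊕ y) ρ = ≃-trans (⊞-hom (norm x) (norm y) ρ) (+ᵣ-cong (correct x ρ) (correct y ρ))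
    correct (x ⊗ y) ρ = ≃-trans (⊠-hom (norm x) (norm y) ρ) (*ᵣ-cong (correct x ρ) (correct y ρ))
    correct (⊝ x)   ρ = ≃-trans (⊟-hom (norm x) ρ) (-ᵣ-cong (correct x ρ))
    correct (x ⊛ i) ρ = ≃-trans (⊡-hom (norm x) i ρ) (^-congˡ i (correct x ρ))

    open import Relation.Binary.Reflection (AlmostCommutativeRing.setoid ℚₚ-ring) Ι ⟦_⟧ ⟦_⇓⟧ correct public
      using (solve)

  open ℚₚ-Solver using (solve)

  infixl 6 _⊖_
  _⊖_ : ∀ {n} → Expr ℤ n → Expr ℤ n → Expr ℤ n
  x ⊖ y = x ⊕ (⊝ y)

  infix 4 _⊜_
  _⊜_ : ∀ {n} → Expr ℤ n → Expr ℤ n → Expr ℤ n × Expr ℤ n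
  _⊜_ = _,_

  p⁻^ : ℕ → RawQ
  p⁻^ k = (λ _ → + 1) , k

  p^*p⁻^ : ∀ m → ⟨ p^ m ⟩ *ᵣ p⁻^ m ≃ 1ᵣ
  p^*p⁻^ m = cross-≡⇒≃ λ _ → identity (p^ m)
    where
    identity : ∀ P → (P * + 1) * + 1 ≡ + 1 * P
    identity = ℤ-Solver.solve-∀

  p^-+ᵣ : ∀ m n → ⟨ p^ m ⟩ *ᵣ ⟨ p^ n ⟩ ≃ ⟨ p^ (m ℕ.+ n) ⟩
  p^-+ᵣ m n = cross-≡⇒≃ λ _ → cong (_* + 1) (sym (p^-+ m n))

  p^*p^*p⁻^ : ∀ m n → ⟨ p^ m ⟩ *ᵣ ⟨ p^ n ⟩ *ᵣ p⁻^ (m ℕ.+ n) ≃ 1ᵣ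
  p^*p^*p⁻^ m n = ≃-trans (*ᵣ-cong (p^-+ᵣ m n) (≃-refl {p⁻^ (m ℕ.+ n)})) (p^*p⁻^ (m ℕ.+ n))

  p⁻^-+ : ∀ m n → p⁻^ (m ℕ.+ n) *ᵣ ⟨ p^ m ⟩ ≃ p⁻^ n
  p⁻^-+ m n = cross-≡⇒≃ λ _ → identity (p^ m) (p^ n) (p^-+ m n) (cong p^ (ℕP.+-identityʳ (m ℕ.+ n)))
    where
    identity : ∀ M N {MN MN0} → MN ≡ M * N → MN0 ≡ MN → (+ 1 * M) * N ≡ + 1 * MN0
    identity M N refl refl = ℤP.*-assoc (+ 1) M N

  -- Integrality

  record Integral (a : RawQ) : Set where
    constructor mkIntegral
    field
      eventually : Σ ℕ λ N → ∀ n → N ℕ.≤ n → p^ (proj₂ a) ∣ˢ proj₁ a n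

  integral-resp : ∀ {a b} → a ≃ b → Integral a → Integral b
  integral-resp {x , k} {y , l} (mk≃ a≃b) (mkIntegral (N₀ , x-int)) =
    let (N₁ , ab) = a≃b (l ℕ.+ k) in
    mkIntegral (N₀ ℕ.⊔ N₁ , λ n N≤n → p^-∣-cancelˡ l k
      (subst (_ ∣ˢ_) (solve-for-y (x n) (y n) (p^ k) (p^ l))
        (∣m∣n⇒∣m-n (subst (_∣ˢ (x n * p^ l)) (cong p^ (ℕP.+-comm k l)) (p^-∣-*ʳ k l (x-int n (≤⊔⇒≤ˡ N≤n))))
                   (ab n (≤⊔⇒≤ʳ N≤n)))))
    where
    solve-for-y : ∀ x y K L → x * L - (x * L - y * K) ≡ K * y
    solve-for-y = ℤ-Solver.solve-∀

  integral-+ : ∀ {a b} → Integral a → Integral b → Integral (a +ᵣ b)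
  integral-+ {x , k} {y , l} (mkIntegral (N₀ , x-int)) (mkIntegral (N₁ , y-int)) =
    mkIntegral (N₀ ℕ.⊔ N₁ , λ n N≤n →
      ∣m∣n⇒∣m+n (p^-∣-*ʳ k l (x-int n (≤⊔⇒≤ˡ N≤n)))
                (subst (_∣ˢ (y n * p^ k)) (cong p^ (ℕP.+-comm l k)) (p^-∣-*ʳ l k (y-int n (≤⊔⇒≤ʳ N≤n)))))

  integral-* : ∀ {a b} → Integral a → Integral b → Integral (a *ᵣ b)
  integral-* {x , k} {y , l} (mkIntegral (N₀ , x-int)) (mkIntegral (N₁ , y-int)) =
    mkIntegral (N₀ ℕ.⊔ N₁ , λ n N≤n →
      subst (_∣ˢ _) (sym (p^-+ k l)) (∣-trans (∣ˢ.*-monoˡ-∣ (p^ l) (x-int n (≤⊔⇒≤ˡ N≤n)))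
                                      (∣ˢ.*-monoʳ-∣ (x n) (y-int n (≤⊔⇒≤ʳ N≤n)))))

  integral-- : ∀ {a} → Integral a → Integral (-ᵣ a)
  integral-- (mkIntegral (N , x-int)) = mkIntegral (N , λ n N≤n → ∣m⇒∣-m (x-int n N≤n))

  integral-⟨⟩ : ∀ c → Integral ⟨ c ⟩
  integral-⟨⟩ c = mkIntegral (0 , λ _ _ → divides c (sym (ℤP.*-identityʳ c)))

  p-not-invertible : ∀ {r} → Integral r → ¬ (1ᵣ ≃ ⟨ p^ 1 ⟩ *ᵣ r)
  p-not-invertible {s , k} (mkIntegral (N₀ , s-int)) (mk≃ 1≃pr) = p^-suc-∤-p^ k p^1+k∣p^k
    where
    N₁ = proj₁ (1≃pr (suc k))
    n = N₀ ℕ.⊔ N₁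
    p^1+k∣1-ps : p^ (suc k) ∣ˢ (+ 1 * p^ k - (p^ 1 * s n) * + 1)
    p^1+k∣1-ps = proj₂ (1≃pr (suc k)) n (ℕP.m≤n⊔m N₀ N₁)
    p^1+k∣ps : p^ (suc k) ∣ˢ ((p^ 1 * s n) * + 1)
    p^1+k∣ps = subst₂ _∣ˢ_ (sym (p^-+ 1 k)) (sym (ℤP.*-identityʳ _))
      (∣ˢ.*-monoʳ-∣ (p^ 1) (s-int n (ℕP.m≤m⊔n N₀ N₁)))
    p^1+k∣p^k : p^ (suc k) ∣ˢ p^ k
    p^1+k∣p^k = subst (p^ (suc k) ∣ˢ_) (ℤP.*-identityˡ (p^ k))
      (∣ˢ.∣m+n∣n⇒∣m p^1+k∣1-ps (∣m⇒∣-m p^1+k∣ps))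

  integral-*p^ : ∀ a m → proj₂ a ℕ.≤ m → Integral (a *ᵣ ⟨ p^ m ⟩)
  integral-*p^ (x , k) m k≤m = mkIntegral (0 , λ n _ →
    subst (λ t → p^ t ∣ˢ (x n * p^ m)) (sym (ℕP.+-identityʳ k)) (∣n⇒∣m*n (x n) (p^-mono-∣ k≤m)))

  -- p^(1+e) − 1 is a unit of ℤ_p: X p^m = X p^(1+e+m) − (X p^(1+e) − X) p^m lowers m by 1+e,
  -- from a multiple of 1+e above the exponent of X (where X p^m is integral) down to 0.
  integral-cancel-p^-1 : ∀ e X → Integral (X *ᵣ ⟨ p^ (suc e) ⟩ -ᵣ X) → Integral X
  integral-cancel-p^-1 e X U-integral =
    integral-resp (*ᵣ-identityʳ X) (descend (proj₂ X) (integral-*p^ X (proj₂ X ℕ.* suc e) (ℕP.m≤m*n (proj₂ X) (suc e))))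
    where
    U = X *ᵣ ⟨ p^ (suc e) ⟩ -ᵣ X
    step : ∀ m → Integral (X *ᵣ ⟨ p^ (suc e ℕ.+ m) ⟩) → Integral (X *ᵣ ⟨ p^ m ⟩)
    step m integral = integral-resp
      (solve 3 (λ X P Q → X ⊗ (P ⊗ Q) ⊖ (X ⊗ P ⊖ X) ⊗ Q ⊜ X ⊗ Q) ≃-refl X ⟨ p^ (suc e) ⟩ ⟨ p^ m ⟩)
      (integral-+ {X *ᵣ (⟨ p^ (suc e) ⟩ *ᵣ ⟨ p^ m ⟩)} { -ᵣ (U *ᵣ ⟨ p^ m ⟩)}
        (integral-resp (*ᵣ-cong (≃-refl {X}) (≃-sym (p^-+ᵣ (suc e) m))) integral)
        (integral-- (integral-* {U} U-integral (integral-⟨⟩ (p^ m)))))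
    descend : ∀ m → Integral (X *ᵣ ⟨ p^ (m ℕ.* suc e) ⟩) → Integral (X *ᵣ ⟨ p^ 0 ⟩)
    descend zero integral = integral
    descend (suc m) integral = descend m (step (m ℕ.* suc e) integral)

  Coherentᵣ : RawQ → Set
  Coherentᵣ a = Coherent p (proj₁ a)

  coherent-step : ∀ f → Coherent p f → ∀ n → p^ n ∣ˢ (f (suc n) - f n)
  coherent-step f f-coh n = ∣ˢ.∣ᵤ⇒∣ (f-coh n)

  coherent-⟨⟩ : ∀ c → Coherentᵣ ⟨ c ⟩
  coherent-⟨⟩ c n = ∣ˢ.∣⇒∣ᵤ (subst (p^ n ∣ˢ_) (sym (ℤP.+-inverseʳ c)) ∣0)

  coherent-+ : ∀ {a b} → Coherentᵣ a → Coherentᵣ b → Coherentᵣ (a +ᵣ b)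
  coherent-+ {x , k} {y , l} x-coh y-coh n = ∣ˢ.∣⇒∣ᵤ
    (subst (_ ∣ˢ_) (sym (difference (x n) (x (suc n)) (y n) (y (suc n)) (p^ k) (p^ l)))
      (∣m∣n⇒∣m+n (∣m⇒∣m*n (p^ l) (coherent-step x x-coh n)) (∣m⇒∣m*n (p^ k) (coherent-step y y-coh n))))
    where
    difference : ∀ f f' g g' A B → (f' * B + g' * A) - (f * B + g * A) ≡ (f' - f) * B + (g' - g) * A
    difference = ℤ-Solver.solve-∀

  coherent-* : ∀ {a b} → Coherentᵣ a → Coherentᵣ b → Coherentᵣ (a *ᵣ b)
  coherent-* {x , k} {y , l} x-coh y-coh n = ∣ˢ.∣⇒∣ᵤ
    (subst (_ ∣ˢ_) (sym (difference (x n) (x (suc n)) (y n) (y (suc n))))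
      (∣m∣n⇒∣m+n (∣m⇒∣m*n (y (suc n)) (coherent-step x x-coh n)) (∣n⇒∣m*n (x n) (coherent-step y y-coh n))))
    where
    difference : ∀ f f' g g' → f' * g' - f * g ≡ (f' - f) * g' + f * (g' - g)
    difference = ℤ-Solver.solve-∀

  coherent-- : ∀ {a} → Coherentᵣ a → Coherentᵣ (-ᵣ a)
  coherent-- {x , k} x-coh n = ∣ˢ.∣⇒∣ᵤ
    (subst (_ ∣ˢ_) (ℤP.neg-distrib-+ (x (suc n)) (- x n)) (∣m⇒∣-m (coherent-step x x-coh n)))

  coherent-∣ : ∀ f → Coherent p f → ∀ {k n} → k ℕ.≤ n → p^ k ∣ˢ (f n - f k)
  coherent-∣ x x-coh {k} {n} k≤n =
    subst (λ t → p^ k ∣ˢ (x t - x k)) (ℕP.m∸n+n≡m k≤n) (telescope (n ℕ.∸ k))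
    where
    telescope : ∀ j → p^ k ∣ˢ (x (j ℕ.+ k) - x k)
    telescope zero = subst (_ ∣ˢ_) (sym (ℤP.+-inverseʳ (x k))) ∣0
    telescope (suc j) = subst (_ ∣ˢ_) (ℤP.+-minus-telescope (x (suc (j ℕ.+ k))) (x (j ℕ.+ k)) (x k))
      (∣m∣n⇒∣m+n (p^-∣-weaken (ℕP.m≤n+m k j) (coherent-step x x-coh (j ℕ.+ k))) (telescope j))

  -- On coherent sequences ValNonneg, which only inspects index k, is integrality.
  valNonneg⇒integral : ∀ {a} → Coherentᵣ a → ValNonneg p a → Integral a
  valNonneg⇒integral {x , k} x-coh p^k∣xk = mkIntegral (k , λ n k≤n →
    ∣ˢ.∣m+n∣n⇒∣m (coherent-∣ x x-coh k≤n) (∣m⇒∣-m (∣ˢ.∣ᵤ⇒∣ {p^ k} {x k} p^k∣xk)))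

  ≈⇒≃ : ∀ {a b} → a ≈[ p ] b → a ≃ b
  ≈⇒≃ a≈b = mk≃ λ m → m , λ n m≤n → p^-∣-weaken m≤n (∣ˢ.∣ᵤ⇒∣ {p^ n} (a≈b n))

  ≃⇒≈ : ∀ {a b} → Coherentᵣ a → Coherentᵣ b → a ≃ b → a ≈[ p ] b
  ≃⇒≈ {x , k} {y , l} x-coh y-coh (mk≃ a≃b) n = ∣ˢ.∣⇒∣ᵤ
    (subst (_ ∣ˢ_) (sym (shift (x n) (y n) (x n') (y n') (p^ l) (p^ k)))
      (∣m∣n⇒∣m+n (∣m∣n⇒∣m-n (proj₂ (a≃b n) n' (ℕP.m≤n⊔m n (proj₁ (a≃b n))))
                            (∣m⇒∣m*n (p^ l) (coherent-∣ x x-coh n≤n')))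
                 (∣m⇒∣m*n (p^ k) (coherent-∣ y y-coh n≤n'))))
    where
    n' = n ℕ.⊔ proj₁ (a≃b n)
    n≤n' = ℕP.m≤m⊔n n (proj₁ (a≃b n))
    shift : ∀ x y x' y' L K → x * L - y * K ≡ (x' * L - y' * K) - (x' - x) * L + (y' - y) * K
    shift = ℤ-Solver.solve-∀

  coherent : (q : Qp p) → Coherentᵣ (raw q)
  coherent q = proj₂ (proj₁ q)

  infixl 6 _+ₚ_
  infixl 7 _*ₚ_

  _+ₚ_ _*ₚ_ : Qp p → Qp p → Qp p
  q +ₚ r = (proj₁ (raw q +ᵣ raw r) , coherent-+ {raw q} {raw r} (coherent q) (coherent r)) , proj₂ (raw q +ᵣ raw r)
  q *ₚ r = (proj₁ (raw q *ᵣ raw r) , coherent-* {raw q} {raw r} (coherent q) (coherent r)) , proj₂ (raw q *ᵣ raw r)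

  -ₚ_ : Qp p → Qp p
  -ₚ q = (proj₁ (-ᵣ raw q) , coherent-- {raw q} (coherent q)) , proj₂ (raw q)

  infix 5 _/p^_
  _/p^_ : ℤ → ℕ → Qp p
  c /p^ k = ((λ _ → c) , coherent-⟨⟩ c) , k

  mulMₚ : Mat (Qp p) → Mat (Qp p) → Mat (Qp p)
  mulMₚ (mat a b c d) (mat a' b' c' d') =
    mat (a *ₚ a' +ₚ b *ₚ c') (a *ₚ b' +ₚ b *ₚ d') (c *ₚ a' +ₚ d *ₚ c') (c *ₚ b' +ₚ d *ₚ d')

  adjugate : Mat RawQ → Mat RawQ
  adjugate (mat a b c d) = mat d (-ᵣ b) (-ᵣ c) a

  adjugateₚ : Mat (Qp p) → Mat (Qp p)
  adjugateₚ (mat a b c d) = mat d (-ₚ b) (-ₚ c) a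

  det-coherent : (M : Mat (Qp p)) → Coherentᵣ (det p (rawM M))
  det-coherent (mat a b c d) = coherent-+ {raw a *ᵣ raw d} { -ᵣ (raw b *ᵣ raw c)}
    (coherent-* {raw a} {raw d} (coherent a) (coherent d))
    (coherent-- {raw b *ᵣ raw c} (coherent-* {raw b} {raw c} (coherent b) (coherent c)))

  tr-coherent : (M : Mat (Qp p)) → Coherentᵣ (tr p (rawM M))
  tr-coherent (mat a b c d) = coherent-+ {raw a} {raw d} (coherent a) (coherent d)

  det-mulM : ∀ a b c d e f g i →
             det p (mulM p (mat a b c d) (mat e f g i)) ≃ det p (mat a b c d) *ᵣ det p (mat e f g i)
  det-mulM = solve 8 (λ a b c d e f g i →
    (a ⊗ e ⊕ b ⊗ g) ⊗ (c ⊗ f ⊕ d ⊗ i) ⊖ (a ⊗ f ⊕ b ⊗ i) ⊗ (c ⊗ e ⊕ d ⊗ g)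
    ⊜ (a ⊗ d ⊖ b ⊗ c) ⊗ (e ⊗ i ⊖ f ⊗ g)) ≃-refl

  det-adjugate : ∀ a b c d → det p (adjugate (mat a b c d)) ≃ det p (mat a b c d)
  det-adjugate = solve 4 (λ a b c d → d ⊗ a ⊖ (⊝ b) ⊗ (⊝ c) ⊜ a ⊗ d ⊖ b ⊗ c) ≃-refl

  sl2-from-≃ : (M : Mat (Qp p)) → det p (rawM M) ≃ 1ᵣ → SL2 p
  sl2-from-≃ M det≃1 = sl2 M (≃⇒≈ {det p (rawM M)} {1ᵣ} (det-coherent M) (coherent-⟨⟩ (+ 1)) det≃1)

  det≃1 : (g : SL2 p) → det p (rawM (entries g)) ≃ 1ᵣ
  det≃1 g = ≈⇒≃ {det p (rawM (entries g))} {1ᵣ} (det≈1 g)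

  mulSL : SL2 p → SL2 p → SL2 p
  mulSL h@(sl2 (mat a b c d) _) A@(sl2 (mat e f g i) _) = sl2-from-≃ (mulMₚ (entries h) (entries A))
    (≃-trans (det-mulM (raw a) (raw b) (raw c) (raw d) (raw e) (raw f) (raw g) (raw i))
      (≃-trans (*ᵣ-cong (det≃1 h) (det≃1 A)) (*ᵣ-identityˡ 1ᵣ)))

  adjugateSL : SL2 p → SL2 p
  adjugateSL h@(sl2 (mat a b c d) _) = sl2-from-≃ (adjugateₚ (entries h))
    (≃-trans (det-adjugate (raw a) (raw b) (raw c) (raw d)) (det≃1 h))

  infix 4 _≃M_
  _≃M_ : Mat RawQ → Mat RawQ → Set
  M ≃M N = (a M ≃ a N) × (b M ≃ b N) × (c M ≃ c N) × (d M ≃ d N)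

  ≃M⇒≈M : (M N : Mat (Qp p)) → rawM M ≃M rawM N → rawM M ≈M[ p ] rawM N
  ≃M⇒≈M (mat a b c d) (mat a' b' c' d') (a≃ , b≃ , c≃ , d≃) =
    ≃⇒≈ {raw a} {raw a'} (coherent a) (coherent a') a≃ , ≃⇒≈ {raw b} {raw b'} (coherent b) (coherent b') b≃ ,
    ≃⇒≈ {raw c} {raw c'} (coherent c) (coherent c') c≃ , ≃⇒≈ {raw d} {raw d'} (coherent d) (coherent d') d≃

  ≈M⇒≃M : ∀ {M N} → M ≈M[ p ] N → M ≃M N
  ≈M⇒≃M {mat a b c d} {mat a' b' c' d'} (a≈ , b≈ , c≈ , d≈) =
    ≈⇒≃ {a} {a'} a≈ , ≈⇒≃ {b} {b'} b≈ , ≈⇒≃ {c} {c'} c≈ , ≈⇒≃ {d} {d'} d≈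

  adjugate-mulM : ∀ a b c d e f g i → let D = det p (mat a b c d) in
    mulM p (adjugate (mat a b c d)) (mulM p (mat a b c d) (mat e f g i)) ≃M mat (D *ᵣ e) (D *ᵣ f) (D *ᵣ g) (D *ᵣ i)
  adjugate-mulM a b c d e f g i =
    solve 8 (λ a b c d e f g i → d ⊗ (a ⊗ e ⊕ b ⊗ g) ⊕ (⊝ b) ⊗ (c ⊗ e ⊕ d ⊗ g) ⊜ (a ⊗ d ⊖ b ⊗ c) ⊗ e)
      ≃-refl a b c d e f g i ,
    solve 8 (λ a b c d e f g i → d ⊗ (a ⊗ f ⊕ b ⊗ i) ⊕ (⊝ b) ⊗ (c ⊗ f ⊕ d ⊗ i) ⊜ (a ⊗ d ⊖ b ⊗ c) ⊗ f)
      ≃-refl a b c d e f g i ,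
    solve 8 (λ a b c d e f g i → (⊝ c) ⊗ (a ⊗ e ⊕ b ⊗ g) ⊕ a ⊗ (c ⊗ e ⊕ d ⊗ g) ⊜ (a ⊗ d ⊖ b ⊗ c) ⊗ g)
      ≃-refl a b c d e f g i ,
    solve 8 (λ a b c d e f g i → (⊝ c) ⊗ (a ⊗ f ⊕ b ⊗ i) ⊕ a ⊗ (c ⊗ f ⊕ d ⊗ i) ⊜ (a ⊗ d ⊖ b ⊗ c) ⊗ i)
      ≃-refl a b c d e f g i

  mulM-adjugate-cancel : ∀ H A → det p H ≃ 1ᵣ → A ≃M mulM p (adjugate H) (mulM p H A)
  mulM-adjugate-cancel (mat a b c d) (mat e f g i) det≃1 =
    let (a≃ , b≃ , c≃ , d≃) = adjugate-mulM a b c d e f g i in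
    cancel a≃ , cancel b≃ , cancel c≃ , cancel d≃
    where
    cancel : ∀ {x y} → y ≃ det p (mat a b c d) *ᵣ x → x ≃ y
    cancel y≃Dx = ≃-sym (≃-trans y≃Dx (≃-trans (*ᵣ-cong det≃1 ≃-refl) (*ᵣ-identityˡ _)))

  ∈-adjugate-translate : ∀ {X : SL2 p → Set} (h A : SL2 p) → X (mulSL h A) → InTranslate X (adjugateSL h) A
  ∈-adjugate-translate h A hA∈X = mulSL h A , hA∈X ,
    ≃M⇒≈M (entries A) (mulMₚ (adjugateₚ (entries h)) (mulMₚ (entries h) (entries A)))
      (mulM-adjugate-cancel (rawM (entries h)) (rawM (entries A)) (det≃1 h))

  mulM-congʳ : ∀ G {A A'} → A ≃M A' → mulM p G A ≃M mulM p G A'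
  mulM-congʳ (mat a b c d) (e≃ , f≃ , g≃ , i≃) =
    +ᵣ-cong (*ᵣ-cong (≃-refl {a}) e≃) (*ᵣ-cong (≃-refl {b}) g≃) ,
    +ᵣ-cong (*ᵣ-cong (≃-refl {a}) f≃) (*ᵣ-cong (≃-refl {b}) i≃) ,
    +ᵣ-cong (*ᵣ-cong (≃-refl {c}) e≃) (*ᵣ-cong (≃-refl {d}) g≃) ,
    +ᵣ-cong (*ᵣ-cong (≃-refl {c}) f≃) (*ᵣ-cong (≃-refl {d}) i≃)

  tr-cong : ∀ {A A'} → A ≃M A' → tr p A ≃ tr p A'
  tr-cong (a≃ , _ , _ , d≃) = +ᵣ-cong a≃ d≃

  trace-integral : (B : SL2 p) → W' p B → Integral (tr p (rawM (entries B)))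
  trace-integral B = valNonneg⇒integral {tr p (rawM (entries B))} (tr-coherent (entries B))

  -- W is generic

  generic-of-probes : ∀ {X : SL2 p → Set} (hs : List (SL2 p)) → (∀ A → Any (λ h → X (mulSL h A)) hs) → Generic X
  generic-of-probes {X} hs hit = List.map adjugateSL hs , λ A →
    Any.map⁺ (Any.map (λ {h} → ∈-adjugate-translate {X} h A) (hit A))

  W'? : ∀ B → Dec (W' p B)
  W'? B = let (x , k) = tr p (rawM (entries B)) in ℤ.∣ p^ k ∣ ℕD.∣? ℤ.∣ x k ∣

  -- Writing x′ = x/p and y′ = y/p, the four traces make x′, y′, x + w and z − y integral,
  -- hence also x = p x′, y = p y′, w and z, and then det = p (x′ w − y′ z) is divisible by p.
  four-traces-not-integral : ∀ x y z w → det p (mat x y z w) ≃ 1ᵣ →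
    Integral (x +ᵣ w) → Integral (z -ᵣ y) → Integral (p⁻^ 1 *ᵣ x +ᵣ z -ᵣ y) → Integral (x +ᵣ p⁻^ 1 *ᵣ y +ᵣ w) → ⊥
  four-traces-not-integral x y z w det≃1 x+w z-y x′+z-y x+y′+w = p-not-invertible det/p-integral det≃p·det/p
    where
    x′ = p⁻^ 1 *ᵣ x
    y′ = p⁻^ 1 *ᵣ y
    x′-integral : Integral x′
    x′-integral = integral-resp (solve 4 (λ x′ x y z → x′ ⊕ z ⊖ y ⊖ (z ⊖ y) ⊜ x′) ≃-refl x′ x y z)
      (integral-+ x′+z-y (integral-- z-y))
    y′-integral : Integral y′
    y′-integral = integral-resp (solve 4 (λ x y′ y w → x ⊕ y′ ⊕ w ⊖ (x ⊕ w) ⊜ y′) ≃-refl x y′ y w)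
      (integral-+ x+y′+w (integral-- x+w))
    p·/p : ∀ u → ⟨ p^ 1 ⟩ *ᵣ (p⁻^ 1 *ᵣ u) ≃ u
    p·/p u = ≃-trans (≃-sym (*ᵣ-assoc ⟨ p^ 1 ⟩ (p⁻^ 1) u)) (≃-trans (*ᵣ-cong (p^*p⁻^ 1) ≃-refl) (*ᵣ-identityˡ u))
    x-integral : Integral x
    x-integral = integral-resp (p·/p x) (integral-* (integral-⟨⟩ (p^ 1)) x′-integral)
    y-integral : Integral y
    y-integral = integral-resp (p·/p y) (integral-* (integral-⟨⟩ (p^ 1)) y′-integral)
    w-integral : Integral w
    w-integral = integral-resp (solve 2 (λ x w → x ⊕ w ⊖ x ⊜ w) ≃-refl x w) (integral-+ x+w (integral-- x-integral))
    z-integral : Integral z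
    z-integral = integral-resp (solve 2 (λ y z → z ⊖ y ⊕ y ⊜ z) ≃-refl y z) (integral-+ z-y y-integral)
    det/p = x′ *ᵣ w -ᵣ y′ *ᵣ z
    det/p-integral : Integral det/p
    det/p-integral = integral-+ (integral-* x′-integral w-integral) (integral-- (integral-* y′-integral z-integral))
    det≃p·det/p : 1ᵣ ≃ ⟨ p^ 1 ⟩ *ᵣ det/p
    det≃p·det/p = ≃-trans (≃-sym det≃1) (≃-trans
      (+ᵣ-cong (*ᵣ-cong (≃-sym (p·/p x)) ≃-refl) (-ᵣ-cong (*ᵣ-cong (≃-sym (p·/p y)) ≃-refl)))
      (solve 5 (λ P x′ y′ z w → (P ⊗ x′) ⊗ w ⊖ (P ⊗ y′) ⊗ z ⊜ P ⊗ (x′ ⊗ w ⊖ y′ ⊗ z)) ≃-refl ⟨ p^ 1 ⟩ x′ y′ z w))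

  I₂ S S/p L/p : SL2 p
  I₂ = sl2-from-≃ (mat (+ 1 /p^ 0) (+ 0 /p^ 0) (+ 0 /p^ 0) (+ 1 /p^ 0))
    (solve 0 (Κ (+ 1) ⊗ Κ (+ 1) ⊖ Κ (+ 0) ⊗ Κ (+ 0) ⊜ Κ (+ 1)) ≃-refl)
  S = sl2-from-≃ (mat (+ 0 /p^ 0) (+ 1 /p^ 0) (-[1+ 0 ] /p^ 0) (+ 0 /p^ 0))
    (solve 0 (Κ (+ 0) ⊗ Κ (+ 0) ⊖ Κ (+ 1) ⊗ Κ -[1+ 0 ] ⊜ Κ (+ 1)) ≃-refl)
  S/p = sl2-from-≃ (mat (+ 1 /p^ 1) (+ 1 /p^ 0) (-[1+ 0 ] /p^ 0) (+ 0 /p^ 0))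
    (solve 1 (λ t → t ⊗ Κ (+ 0) ⊖ Κ (+ 1) ⊗ Κ -[1+ 0 ] ⊜ Κ (+ 1)) ≃-refl (p⁻^ 1))
  L/p = sl2-from-≃ (mat (+ 1 /p^ 0) (+ 0 /p^ 0) (+ 1 /p^ 1) (+ 1 /p^ 0))
    (solve 1 (λ t → Κ (+ 1) ⊗ Κ (+ 1) ⊖ Κ (+ 0) ⊗ t ⊜ Κ (+ 1)) ≃-refl (p⁻^ 1))

  probes : List (SL2 p)
  probes = I₂ ∷ S ∷ S/p ∷ L/p ∷ []

  probe-traces-not-all-integral : ∀ A → ¬ All (λ h → W' p (mulSL h A)) probes
  probe-traces-not-all-integral A@(sl2 (mat x y z w) _) (I₂A ∷ SA ∷ S/pA ∷ L/pA ∷ []) =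
    four-traces-not-integral (raw x) (raw y) (raw z) (raw w) (det≃1 A)
      (integral-resp (tr-I₂ (raw x) (raw y) (raw z) (raw w)) (trace-integral (mulSL I₂ A) I₂A))
      (integral-resp (tr-S (raw x) (raw y) (raw z) (raw w)) (trace-integral (mulSL S A) SA))
      (integral-resp (tr-S/p (p⁻^ 1) (raw x) (raw y) (raw z) (raw w)) (trace-integral (mulSL S/p A) S/pA))
      (integral-resp (tr-L/p (p⁻^ 1) (raw x) (raw y) (raw z) (raw w)) (trace-integral (mulSL L/p A) L/pA))
    where
    tr-I₂ : ∀ x y z w → tr p (mulM p (mat ⟨ + 1 ⟩ ⟨ + 0 ⟩ ⟨ + 0 ⟩ ⟨ + 1 ⟩) (mat x y z w)) ≃ x +ᵣ w
    tr-I₂ = solve 4 (λ x y z w → (Κ (+ 1) ⊗ x ⊕ Κ (+ 0) ⊗ z) ⊕ (Κ (+ 0) ⊗ y ⊕ Κ (+ 1) ⊗ w) ⊜ x ⊕ w) ≃-refl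
    tr-S : ∀ x y z w → tr p (mulM p (mat ⟨ + 0 ⟩ ⟨ + 1 ⟩ ⟨ -[1+ 0 ] ⟩ ⟨ + 0 ⟩) (mat x y z w)) ≃ z -ᵣ y
    tr-S = solve 4 (λ x y z w → (Κ (+ 0) ⊗ x ⊕ Κ (+ 1) ⊗ z) ⊕ (Κ -[1+ 0 ] ⊗ y ⊕ Κ (+ 0) ⊗ w) ⊜ z ⊖ y) ≃-refl
    tr-S/p : ∀ t x y z w → tr p (mulM p (mat t ⟨ + 1 ⟩ ⟨ -[1+ 0 ] ⟩ ⟨ + 0 ⟩) (mat x y z w)) ≃ t *ᵣ x +ᵣ z -ᵣ y
    tr-S/p = solve 5 (λ t x y z w → (t ⊗ x ⊕ Κ (+ 1) ⊗ z) ⊕ (Κ -[1+ 0 ] ⊗ y ⊕ Κ (+ 0) ⊗ w) ⊜ t ⊗ x ⊕ z ⊖ y) ≃-refl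
    tr-L/p : ∀ t x y z w → tr p (mulM p (mat ⟨ + 1 ⟩ ⟨ + 0 ⟩ t ⟨ + 1 ⟩) (mat x y z w)) ≃ x +ᵣ t *ᵣ y +ᵣ w
    tr-L/p = solve 5 (λ t x y z w → (Κ (+ 1) ⊗ x ⊕ Κ (+ 0) ⊗ z) ⊕ (t ⊗ y ⊕ Κ (+ 1) ⊗ w) ⊜ x ⊕ t ⊗ y ⊕ w) ≃-refl

  W-generic : Generic (W p)
  W-generic = generic-of-probes {W p} probes λ A →
    ¬All⇒Any¬ (λ h → W'? (mulSL h A)) probes (probe-traces-not-all-integral A)

  -- W′ is not generic

  not-generic-of-separated : ∀ {X : SL2 p → Set} →
    (∀ gs → Σ (ℕ → SL2 p) λ A →
       All (λ g → ∀ {i j} → i ℕ.< j → InTranslate X g (A i) → ¬ InTranslate X g (A j)) gs) →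
    ¬ Generic X
  not-generic-of-separated {X} separated-family (gs , covered) =
    All.lookup separated (∈-lookup (slot i)) i<j (lookup-index (covered (A (Fin.toℕ i))))
      (subst (λ k → InTranslate X (List.lookup gs k) (A (Fin.toℕ j))) (sym slot-i≡slot-j)
        (lookup-index (covered (A (Fin.toℕ j)))))
    where
    A = proj₁ (separated-family gs)
    separated = proj₂ (separated-family gs)
    slot : Fin (suc (List.length gs)) → Fin (List.length gs)
    slot k = Any.index (covered (A (Fin.toℕ k)))
    pigeons = FinP.pigeonhole (ℕP.n<1+n (List.length gs)) slot
    i = proj₁ pigeons
    j = proj₁ (proj₂ pigeons)
    i<j = proj₁ (proj₂ (proj₂ pigeons))
    slot-i≡slot-j = proj₂ (proj₂ (proj₂ pigeons))

  -- If A = g B then tr B = tr (adj(g) A).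
  translate-trace-integral : (g A : SL2 p) → InTranslate (W' p) g A →
    Integral (tr p (mulM p (adjugate (rawM (entries g))) (rawM (entries A))))
  translate-trace-integral g A (B , B∈W' , A≈gB) = integral-resp
    (≃-trans (tr-cong (mulM-adjugate-cancel G (rawM (entries B)) (det≃1 g)))
             (≃-sym (tr-cong (mulM-congʳ (adjugate G) (≈M⇒≃M A≈gB)))))
    (trace-integral B B∈W')
    where G = rawM (entries g)

  upperSL : ℕ → ℕ → SL2 p
  upperSL K m = sl2-from-≃ (mat (+ 1 /p^ suc K) (+ 1 /p^ (suc m ℕ.+ K)) (+ 0 /p^ 0) (p^ (suc K) /p^ 0))
    (≃-trans (solve 3 (λ u v w → u ⊗ w ⊖ v ⊗ Κ (+ 0) ⊜ w ⊗ u) ≃-refl (p⁻^ (suc K)) (p⁻^ (suc m ℕ.+ K)) ⟨ p^ (suc K) ⟩)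
             (p^*p⁻^ (suc K)))

  -- tr (adj(g) · upperSL K m) for g = (a b; c d).
  trace-against : RawQ → RawQ → RawQ → ℕ → ℕ → RawQ
  trace-against a c d K m = d *ᵣ p⁻^ (suc K) -ᵣ c *ᵣ p⁻^ (suc m ℕ.+ K) +ᵣ a *ᵣ ⟨ p^ (suc K) ⟩

  -- The two traces differ by X (p^(J−I) − 1) with X = c p^-(1+J+K), and p^(J−I) − 1 is a unit.
  integral-c/p^ : ∀ a c d K {I J} → I ℕ.< J →
    Integral (trace-against a c d K I) → Integral (trace-against a c d K J) → Integral (c *ᵣ p⁻^ (suc I ℕ.+ K))
  integral-c/p^ a c d K {I} {J} I<J T_I-integral T_J-integral =
    integral-resp X*p^e≃c/p^ (integral-* X-integral (integral-⟨⟩ (p^ (suc e))))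
    where
    e = J ℕ.∸ suc I
    X = c *ᵣ p⁻^ (suc J ℕ.+ K)
    exponents : suc e ℕ.+ (suc I ℕ.+ K) ≡ suc J ℕ.+ K
    exponents = cong suc (trans (sym (ℕP.+-assoc e (suc I) K)) (cong (ℕ._+ K) (ℕP.m∸n+n≡m I<J)))
    X*p^e≃c/p^ : X *ᵣ ⟨ p^ (suc e) ⟩ ≃ c *ᵣ p⁻^ (suc I ℕ.+ K)
    X*p^e≃c/p^ = ≃-trans (*ᵣ-assoc c (p⁻^ (suc J ℕ.+ K)) ⟨ p^ (suc e) ⟩)
      (*ᵣ-cong (≃-refl {c}) (subst (λ t → p⁻^ t *ᵣ ⟨ p^ (suc e) ⟩ ≃ p⁻^ (suc I ℕ.+ K)) exponents
                                   (p⁻^-+ (suc e) (suc I ℕ.+ K))))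
    T_J-T_I : trace-against a c d K J -ᵣ trace-against a c d K I ≃ X *ᵣ ⟨ p^ (suc e) ⟩ -ᵣ X
    T_J-T_I = ≃-trans
      (solve 6 (λ d u a w c/p^I X → d ⊗ u ⊖ X ⊕ a ⊗ w ⊖ (d ⊗ u ⊖ c/p^I ⊕ a ⊗ w) ⊜ c/p^I ⊖ X) ≃-refl
        d (p⁻^ (suc K)) a ⟨ p^ (suc K) ⟩ (c *ᵣ p⁻^ (suc I ℕ.+ K)) X)
      (+ᵣ-cong (≃-sym X*p^e≃c/p^) (≃-refl { -ᵣ X}))
    X-integral : Integral X
    X-integral = integral-cancel-p^-1 e X
      (integral-resp T_J-T_I (integral-+ T_J-integral (integral-- T_I-integral)))

  -- Then D = d p^-(1+K) is integral too, and with C = c p^-(1+I+K)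
  -- det g = a d − b c = p ((a p^K) D − (b p^K) C p^I).
  unimodular-trace-not-integral : ∀ a b c d K I → proj₂ a ℕ.≤ K → proj₂ b ℕ.≤ K → det p (mat a b c d) ≃ 1ᵣ →
    Integral (trace-against a c d K I) → Integral (c *ᵣ p⁻^ (suc I ℕ.+ K)) → ⊥
  unimodular-trace-not-integral a b c d K I a≤K b≤K det≃1 T-integral C-integral =
    p-not-invertible r-integral 1≃p·r
    where
    C = c *ᵣ p⁻^ (suc I ℕ.+ K)
    D = d *ᵣ p⁻^ (suc K)
    D-integral : Integral D
    D-integral = integral-resp
      (solve 4 (λ D C a w → D ⊖ C ⊕ a ⊗ w ⊕ C ⊖ a ⊗ w ⊜ D) ≃-refl D C a ⟨ p^ (suc K) ⟩)
      (integral-+ (integral-+ T-integral C-integral) (integral-- (integral-*p^ a (suc K) (ℕP.m≤n⇒m≤1+n a≤K))))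
    r = (a *ᵣ ⟨ p^ K ⟩) *ᵣ D -ᵣ ((b *ᵣ ⟨ p^ K ⟩) *ᵣ C) *ᵣ ⟨ p^ I ⟩
    r-integral : Integral r
    r-integral = integral-+ (integral-* (integral-*p^ a K a≤K) D-integral)
      (integral-- (integral-* (integral-* (integral-*p^ b K b≤K) C-integral) (integral-⟨⟩ (p^ I))))
    unit₁ : ⟨ p^ 1 ⟩ *ᵣ ⟨ p^ K ⟩ *ᵣ p⁻^ (suc K) ≃ 1ᵣ
    unit₁ = p^*p^*p⁻^ 1 K
    unit₂ : ⟨ p^ 1 ⟩ *ᵣ ⟨ p^ I ⟩ *ᵣ ⟨ p^ K ⟩ *ᵣ p⁻^ (suc I ℕ.+ K) ≃ 1ᵣ
    unit₂ = ≃-trans (*ᵣ-cong (*ᵣ-cong (p^-+ᵣ 1 I) (≃-refl {⟨ p^ K ⟩})) (≃-refl {p⁻^ (suc I ℕ.+ K)}))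
                    (p^*p^*p⁻^ (suc I) K)
    1≃p·r : 1ᵣ ≃ ⟨ p^ 1 ⟩ *ᵣ r
    1≃p·r = ≃-sym (begin
      ⟨ p^ 1 ⟩ *ᵣ r
        ≈⟨ solve 9 (λ P Q S u v a b c d →
             P ⊗ ((a ⊗ Q) ⊗ (d ⊗ u) ⊖ ((b ⊗ Q) ⊗ (c ⊗ v)) ⊗ S)
             ⊜ (a ⊗ d) ⊗ (P ⊗ Q ⊗ u) ⊖ (b ⊗ c) ⊗ (P ⊗ S ⊗ Q ⊗ v)) ≃-refl
             ⟨ p^ 1 ⟩ ⟨ p^ K ⟩ ⟨ p^ I ⟩ (p⁻^ (suc K)) (p⁻^ (suc I ℕ.+ K)) a b c d ⟩
      (a *ᵣ d) *ᵣ (⟨ p^ 1 ⟩ *ᵣ ⟨ p^ K ⟩ *ᵣ p⁻^ (suc K)) -ᵣ (b *ᵣ c) *ᵣ (⟨ p^ 1 ⟩ *ᵣ ⟨ p^ I ⟩ *ᵣ ⟨ p^ K ⟩ *ᵣ p⁻^ (suc I ℕ.+ K))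
        ≈⟨ +ᵣ-cong (*ᵣ-cong (≃-refl {a *ᵣ d}) unit₁) (-ᵣ-cong (*ᵣ-cong (≃-refl {b *ᵣ c}) unit₂)) ⟩
      (a *ᵣ d) *ᵣ 1ᵣ -ᵣ (b *ᵣ c) *ᵣ 1ᵣ
        ≈⟨ solve 4 (λ a b c d → (a ⊗ d) ⊗ Κ (+ 1) ⊖ (b ⊗ c) ⊗ Κ (+ 1) ⊜ a ⊗ d ⊖ b ⊗ c) ≃-refl a b c d ⟩
      det p (mat a b c d)
        ≈⟨ det≃1 ⟩
      1ᵣ ∎)
      where open import Relation.Binary.Reasoning.Setoid (AlmostCommutativeRing.setoid ℚₚ-ring)

  top-row-exponent : SL2 p → ℕ
  top-row-exponent g = proj₂ (raw (a (entries g))) ℕ.⊔ proj₂ (raw (b (entries g)))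

  translate-separates : ∀ K (g : SL2 p) → top-row-exponent g ℕ.≤ K → ∀ {I J} → I ℕ.< J →
    InTranslate (W' p) g (upperSL K I) → ¬ InTranslate (W' p) g (upperSL K J)
  translate-separates K g@(sl2 (mat a b c d) _) e≤K {I} {J} I<J in-I in-J =
    unimodular-trace-not-integral (raw a) (raw b) (raw c) (raw d) K I (≤⊔⇒≤ˡ e≤K) (≤⊔⇒≤ʳ e≤K) (det≃1 g)
      T_I-integral (integral-c/p^ (raw a) (raw c) (raw d) K I<J T_I-integral T_J-integral)
    where
    trace-adjugate-upper : ∀ a b c d u v w →
      tr p (mulM p (adjugate (mat a b c d)) (mat u v ⟨ + 0 ⟩ w)) ≃ d *ᵣ u -ᵣ c *ᵣ v +ᵣ a *ᵣ w
    trace-adjugate-upper = solve 7 (λ a b c d u v w →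
      (d ⊗ u ⊕ (⊝ b) ⊗ Κ (+ 0)) ⊕ ((⊝ c) ⊗ v ⊕ a ⊗ w) ⊜ d ⊗ u ⊖ c ⊗ v ⊕ a ⊗ w) ≃-refl
    T-integral : ∀ m → InTranslate (W' p) g (upperSL K m) → Integral (trace-against (raw a) (raw c) (raw d) K m)
    T-integral m in-m = integral-resp
      (trace-adjugate-upper (raw a) (raw b) (raw c) (raw d) (p⁻^ (suc K)) (p⁻^ (suc m ℕ.+ K)) ⟨ p^ (suc K) ⟩)
      (translate-trace-integral g (upperSL K m) in-m)
    T_I-integral = T-integral I in-I
    T_J-integral = T-integral J in-J

  W'-not-generic : ¬ Generic (W' p)
  W'-not-generic = not-generic-of-separated {W' p} λ gs →
    let K = max 0 (List.map top-row-exponent gs) in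
    upperSL K , All.map (λ {g} e≤K {i} {j} → translate-separates K g e≤K {i} {j})
                        (All.map⁻ (xs≤max 0 (List.map top-row-exponent gs)))

mainTheorem5 : (p : ℕ) → Prime p → Generic (W p) × ¬ Generic (W' p)
mainTheorem5 p p-prime = W-generic p p≥2 , W'-not-generic p p≥2
  where
  p≥2 : 2 ℕ.≤ p
  p≥2 = ℕ.nonTrivial⇒n>1 p {{Primality.prime⇒nonTrivial p-prime}}
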